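{- Let $R$ be a conditional bisimulation for a conditional reactive system $\mathcal S$. Then the binary relation $R'=\{(a;d,\ b;d)\mid (a,b,\mathcal C)\in R,\ d\models\mathcal C\}$ is a bisimulation for the reaction relation $\leadsto$, i.e. whenever $(x,y)\in R'$ and $x\leadsto x'$, there is $y'$ with $y\leadsto y'$ and $(x',y')\in R'$, and whenever $(x,y)\in R'$ and $y\leadsto y'$, there is $x'$ with $x\leadsto x'$ and $(x',y')\in R'$.
   Context: Composition of $f\colon A\to B$, $g\colon B\to C$ is written $f;g$. Fix a category $\mathbf C$ with distinguished object $0$ and a representative class $\kappa$ of commuting squares: for every commuting square $\alpha_1;\delta_1=\alpha_2;\delta_2$ there are $(\alpha_1,\alpha_2,\beta_1,\beta_2)\in\kappa$ (a commuting square) and $\gamma$ with $\delta_1=\beta_1;\gamma$, $\delta_2=\beta_2;\gamma$; $\kappa(\alpha_1,\alpha_2)$ is the set of $(\beta_1,\beta_2)$ with $(\alpha_1,\alpha_2,\beta_1,\beta_2)\in\kappa$. Conditions over $A$ are defined inductively as $(A,\mathcal Q,S)$, $\mathcal Q\in\{\forall,\exists\}$, $S$ a finite set of pairs $(h,\mathcal A')$ with $h\colon A\to A'$, $\mathcal A'$ a condition over $A'$. For $a\colon A\to B$: $a\models(A,\forall,S)$ iff for all $(h,\mathcal A')\in S$ and all $g$ with $a=h;g$, $g\models\mathcal A'$; $a\models(A,\exists,S)$ iff some $(h,\mathcal A')\in S$ and $g$ satisfy $a=h;g$, $g\models\mathcal A'$. $\mathcal A\models\mathcal B$: every arrow satisfying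 $\mathcal A$ satisfies $\mathcal B$. Boolean connectives $\neg,\land,\lor$ on conditions over the same root have the standard semantics. Shift along $c\colon A\to B$: $(A,\mathcal Q,S)_{\downarrow c}=(B,\mathcal Q,\{(\beta,\mathcal A'_{\downarrow\alpha})\mid(h,\mathcal A')\in S,(\alpha,\beta)\in\kappa(h,c)\})$; it satisfies $c;d\models\mathcal A\iff d\models\mathcal A_{\downarrow c}$. A conditional reactive system is a set $\mathcal S$ of rules $(\ell,r,\mathcal R)$, $\ell,r\colon0\to I$, $\mathcal R$ a condition over $I$. Reaction: $a\leadsto a'$ iff there are a rule and $c$ with $a=\ell;c$, $a'=r;c$, $c\models\mathcal R$. Context step $a\xrightarrow[C]{f,\ \mathcal A}a'$ ($a\colon0\to J$, $f\colon J\to K$, $a'\colon0\to K$, $\mathcal A$ over $K$): there are a rule $(\ell,r,\mathcal R)$ and $c\colon I\to K$ with $a;f=\ell;c$, $a'=r;c$, $\mathcal A\models\mathcal R_{\downarrow c}$. A conditional relation is a set of triples $(a,b,\mathcal C)$ with $a,b\colon0\to J$ and $\mathcal C$ a condition over $J$. For a possibly infinite family, $\mathcal D\models\bigvee_{i\in I}\mathcal E_i$ means every arrow satisfying $\mathcal D$ satisfies some $\mathcal E_i$. A conditional bisimulation is a conditional relation $R$ such that for each $(a,b,\mathcal C)\in R$ and each context step $a\xrightarrow[C]{f,\ \mathcal A}a'$ there are a (possibly infinite) index set $I$, context steps $b\xrightarrow[C]{f,\ \mathcal B_i}b'_i$ and conditions $\mathcal C'_i$ with $(a',b'_i,\mathcal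 C'_i)\in R$ for all $i$ and $\mathcal A\land\mathcal C_{\downarrow f}\models\bigvee_{i\in I}(\mathcal C'_i\land\mathcal B_i)$; and symmetrically every context step $b\xrightarrow[C]{f,\ \mathcal B}b'$ is answered by context steps $a\xrightarrow[C]{f,\ \mathcal A_j}a'_j$ with $(a'_j,b',\mathcal C'_j)\in R$ and $\mathcal B\land\mathcal C_{\downarrow f}\models\bigvee_j(\mathcal C'_j\land\mathcal A_j)$. -}

module Defs where

open import Level using (Level; _⊔_; suc)
open import Data.Product using (Σ; Σ-syntax; _×_; _,_)
open import Data.Sum using (_⊎_)
open import Data.List using (List; []; _∷_; _++_; map)
open import Data.List.Membership.Propositional using (_∈_)
open import Data.Unit.Polymorphic using (⊤)
open import Data.Empty.Polymorphic using (⊥)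
open import Relation.Binary.PropositionalEquality using (_≡_)

-- A (locally small) category; composition in diagrammatic order f ⨾ g
-- (written f;g in the paper), arrows compared by propositional equality.
record Cat (o h : Level) : Set (suc (o ⊔ h)) where
  infixl 9 _⨾_
  field
    Obj  : Set o
    Hom  : Obj → Obj → Set h
    id   : ∀ {A} → Hom A A
    _⨾_  : ∀ {A B C} → Hom A B → Hom B C → Hom A C
    identityˡ : ∀ {A B} (f : Hom A B) → id ⨾ f ≡ f
    identityʳ : ∀ {A B} (f : Hom A B) → f ⨾ id ≡ f
    assoc : ∀ {A B C D} (f : Hom A B) (g : Hom B C) (k : Hom C D) →
            (f ⨾ g) ⨾ k ≡ f ⨾ (g ⨾ k)

-- For a span
-- (α₁ : A → B₁, α₂ : A → B₂), κ α₁ α₂ lists the cospans (β₁, β₂) such that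
-- (α₁, α₂, β₁, β₂) ∈ κ.  (κ(α₁,α₂) is taken finite so that the shift of a
-- condition is again a condition with finite sets, as required.)
record RepSquares {o h : Level} (𝐂 : Cat o h) : Set (o ⊔ h) where
  open Cat 𝐂
  field
    κ : ∀ {A B₁ B₂} → Hom A B₁ → Hom A B₂ → List (Σ[ D ∈ Obj ] (Hom B₁ D × Hom B₂ D))
    κ-commutes : ∀ {A B₁ B₂} (α₁ : Hom A B₁) (α₂ : Hom A B₂) {D} (β₁ : Hom B₁ D) (β₂ : Hom B₂ D) →
                 (D , β₁ , β₂) ∈ κ α₁ α₂ → α₁ ⨾ β₁ ≡ α₂ ⨾ β₂
    κ-represents : ∀ {A B₁ B₂ E} (α₁ : Hom A B₁) (α₂ : Hom A B₂) (δ₁ : Hom B₁ E) (δ₂ : Hom B₂ E) →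
                   α₁ ⨾ δ₁ ≡ α₂ ⨾ δ₂ →
                   Σ[ D ∈ Obj ] Σ[ β₁ ∈ Hom B₁ D ] Σ[ β₂ ∈ Hom B₂ D ]
                     ((D , β₁ , β₂) ∈ κ α₁ α₂ × Σ[ γ ∈ Hom D E ] (δ₁ ≡ β₁ ⨾ γ × δ₂ ≡ β₂ ⨾ γ))

data Quant : Set where
  ∀Q ∃Q : Quant

module Conditions {o h : Level} (𝐂 : Cat o h) where
  open Cat 𝐂

  data Cond (A : Obj) : Set (o ⊔ h) where
    cond : Quant → List (Σ[ A' ∈ Obj ] (Hom A A' × Cond A')) → Cond A

  Entry : Obj → Set (o ⊔ h)
  Entry A = Σ[ A' ∈ Obj ] (Hom A A' × Cond A')

  mutual
    _⊨_ : ∀ {A B} → Hom A B → Cond A → Set h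
    a ⊨ cond ∀Q S = sat∀ a S
    a ⊨ cond ∃Q S = sat∃ a S

    sat∀ : ∀ {A B} → Hom A B → List (Entry A) → Set h
    sat∀ a [] = ⊤
    sat∀ {B = B} a ((A' , k , 𝒜') ∷ S) = ((g : Hom A' B) → a ≡ k ⨾ g → g ⊨ 𝒜') × sat∀ a S

    sat∃ : ∀ {A B} → Hom A B → List (Entry A) → Set h
    sat∃ a [] = ⊥
    sat∃ {B = B} a ((A' , k , 𝒜') ∷ S) = (Σ[ g ∈ Hom A' B ] (a ≡ k ⨾ g × g ⊨ 𝒜')) ⊎ sat∃ a S

module CRS {o h : Level} (𝐂 : Cat o h) (K : RepSquares 𝐂) (𝟎 : Cat.Obj 𝐂) where
  open Cat 𝐂
  open RepSquares K
  open Conditions 𝐂 public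

  mutual
    _↓_ : ∀ {A B} → Cond A → Hom A B → Cond B
    cond Q S ↓ c = cond Q (shiftList S c)

    shiftList : ∀ {A B} → List (Entry A) → Hom A B → List (Entry B)
    shiftList [] c = []
    shiftList ((A' , k , 𝒜') ∷ S) c =
      map (λ { (D , α , β) → (D , β , 𝒜' ↓ α) }) (κ k c) ++ shiftList S c

  _⊫_ : ∀ {A} → Cond A → Cond A → Set (o ⊔ h)
  _⊫_ {A} 𝒜 ℬ = ∀ {B} (d : Hom A B) → d ⊨ 𝒜 → d ⊨ ℬ

  record Rule : Set (o ⊔ h) where
    constructor rule
    field
      I : Obj
      ℓ r : Hom 𝟎 I
      ℛ : Cond I

  module _ {s : Level} (𝒮 : Rule → Set s) where

    _⇝_ : ∀ {B} → Hom 𝟎 B → Hom 𝟎 B → Set (o ⊔ h ⊔ s)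
    _⇝_ {B} a a' = Σ[ ρ ∈ Rule ] (𝒮 ρ × Σ[ c ∈ Hom (Rule.I ρ) B ]
                     (a ≡ Rule.ℓ ρ ⨾ c × a' ≡ Rule.r ρ ⨾ c × c ⊨ Rule.ℛ ρ))

    CStep : ∀ {J K'} → Hom 𝟎 J → Hom J K' → Cond K' → Hom 𝟎 K' → Set (o ⊔ h ⊔ s)
    CStep {J} {K'} a f 𝒜 a' = Σ[ ρ ∈ Rule ] (𝒮 ρ × Σ[ c ∈ Hom (Rule.I ρ) K' ]
                     (a ⨾ f ≡ Rule.ℓ ρ ⨾ c × a' ≡ Rule.r ρ ⨾ c × 𝒜 ⊫ (Rule.ℛ ρ ↓ c)))

    CondRel : (r : Level) → Set (o ⊔ h ⊔ suc r)
    CondRel r = ∀ {J} → Hom 𝟎 J → Hom 𝟎 J → Cond J → Set r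

    IsCondBisim : ∀ {r} (i : Level) → CondRel r → Set (o ⊔ h ⊔ s ⊔ r ⊔ suc i)
    IsCondBisim {r} i R =
      (∀ {J K'} (a b : Hom 𝟎 J) (𝒞 : Cond J) → R a b 𝒞 →
        ∀ (f : Hom J K') (𝒜 : Cond K') (a' : Hom 𝟎 K') → CStep a f 𝒜 a' →
        Σ[ Ix ∈ Set i ] Σ[ b' ∈ (Ix → Hom 𝟎 K') ] Σ[ ℬ ∈ (Ix → Cond K') ] Σ[ 𝒞' ∈ (Ix → Cond K') ]
          ((∀ j → CStep b f (ℬ j) (b' j)) × (∀ j → R a' (b' j) (𝒞' j)) ×
           (∀ {B} (d : Hom K' B) → d ⊨ 𝒜 → d ⊨ (𝒞 ↓ f) →
              Σ[ j ∈ Ix ] (d ⊨ 𝒞' j × d ⊨ ℬ j))))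
      ×
      (∀ {J K'} (a b : Hom 𝟎 J) (𝒞 : Cond J) → R a b 𝒞 →
        ∀ (f : Hom J K') (ℬ : Cond K') (b' : Hom 𝟎 K') → CStep b f ℬ b' →
        Σ[ Ix ∈ Set i ] Σ[ a' ∈ (Ix → Hom 𝟎 K') ] Σ[ 𝒜 ∈ (Ix → Cond K') ] Σ[ 𝒞' ∈ (Ix → Cond K') ]
          ((∀ j → CStep a f (𝒜 j) (a' j)) × (∀ j → R (a' j) b' (𝒞' j)) ×
           (∀ {B} (d : Hom K' B) → d ⊨ ℬ → d ⊨ (𝒞 ↓ f) →
              Σ[ j ∈ Ix ] (d ⊨ 𝒞' j × d ⊨ 𝒜 j))))

    Closure : ∀ {r} → CondRel r → ∀ {B} → Hom 𝟎 B → Hom 𝟎 B → Set (o ⊔ h ⊔ r)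
    Closure R {B} x y = Σ[ J ∈ Obj ] Σ[ a ∈ Hom 𝟎 J ] Σ[ b ∈ Hom 𝟎 J ] Σ[ 𝒞 ∈ Cond J ]
      (R a b 𝒞 × Σ[ d ∈ Hom J B ] (d ⊨ 𝒞 × x ≡ a ⨾ d × y ≡ b ⨾ d))

    IsBisim : ∀ {t} → (∀ {B} → Hom 𝟎 B → Hom 𝟎 B → Set t) → Set (o ⊔ h ⊔ s ⊔ t)
    IsBisim P =
      (∀ {B} (x y x' : Hom 𝟎 B) → P x y → x ⇝ x' → Σ[ y' ∈ Hom 𝟎 B ] (y ⇝ y' × P x' y'))
      ×
      (∀ {B} (x y y' : Hom 𝟎 B) → P x y → y ⇝ y' → Σ[ x' ∈ Hom 𝟎 B ] (x ⇝ x' × P x' y'))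

-- Suppose x = a;d ⇝ x' by a rule (ℓ,r,ℛ) with match c, so a;d = ℓ;c,
-- x' = r;c and c ⊨ ℛ.  Then a --[d, ℛ↓c]--> x' is a context step, and R
-- answers it by context steps b --[d, ℬⱼ]--> b'ⱼ with (x', b'ⱼ, 𝒞'ⱼ) ∈ R and
-- ℛ↓c ∧ 𝒞↓d ⊨ ⋁ⱼ (𝒞'ⱼ ∧ ℬⱼ).  The identity on the target satisfies both
-- ℛ↓c and 𝒞↓d (by the shift property, since c ⊨ ℛ and d ⊨ 𝒞), hence some
-- 𝒞'ⱼ ∧ ℬⱼ; so b;d ⇝ b'ⱼ is a reaction and (x', b'ⱼ) = (x';id, b'ⱼ;id) ∈ R'.
--
-- The theorem combines these; the backward half is the forward
-- half applied to the converse relation.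

module Submission where

open import Defs
open import Level using (Level; _⊔_)
open import Data.Product using (Σ-syntax; _×_; _,_)
open import Data.Sum using (inj₁; inj₂)
open import Data.List using (List; []; _∷_)
open import Data.List.Membership.Propositional using (_∈_; find; lose)
open import Data.List.Relation.Unary.All as All using (All; []; _∷_)
open import Data.List.Relation.Unary.Any using (Any; here; there)
import Data.List.Relation.Unary.All.Properties as Allₚ
import Data.List.Relation.Unary.Any.Properties as Anyₚ
open import Data.Unit.Polymorphic using (tt)
open import Relation.Binary.PropositionalEquality using (_≡_; sym; trans; cong; subst; module ≡-Reasoning)

module ClauseSatisfaction {o h : Level} (𝐂 : Cat o h) where
  open Cat 𝐂
  open Conditions 𝐂

  Forces : ∀ {A B} → Hom A B → Entry A → Set h
  Forces {B = B} d (A' , k , 𝒜') = (g : Hom A' B) → d ≡ k ⨾ g → g ⊨ 𝒜'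

  Witnesses : ∀ {A B} → Hom A B → Entry A → Set h
  Witnesses {B = B} d (A' , k , 𝒜') = Σ[ g ∈ Hom A' B ] (d ≡ k ⨾ g × g ⊨ 𝒜')

  sat∀⇒All : ∀ {A B} {d : Hom A B} (S : List (Entry A)) → sat∀ d S → All (Forces d) S
  sat∀⇒All []                  _        = []
  sat∀⇒All ((_ , _ , _) ∷ S) (p , ps) = p ∷ sat∀⇒All S ps

  All⇒sat∀ : ∀ {A B} {d : Hom A B} (S : List (Entry A)) → All (Forces d) S → sat∀ d S
  All⇒sat∀ []                  []       = tt
  All⇒sat∀ ((_ , _ , _) ∷ S) (p ∷ ps) = p , All⇒sat∀ S ps

  sat∃⇒Any : ∀ {A B} {d : Hom A B} (S : List (Entry A)) → sat∃ d S → Any (Witnesses d) S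
  sat∃⇒Any ((_ , _ , _) ∷ S) (inj₁ p) = here p
  sat∃⇒Any ((_ , _ , _) ∷ S) (inj₂ p) = there (sat∃⇒Any S p)

  Any⇒sat∃ : ∀ {A B} {d : Hom A B} (S : List (Entry A)) → Any (Witnesses d) S → sat∃ d S
  Any⇒sat∃ ((_ , _ , _) ∷ S) (here p)  = inj₁ p
  Any⇒sat∃ ((_ , _ , _) ∷ S) (there p) = inj₂ (Any⇒sat∃ S p)

module ShiftProperty {o h : Level} (𝐂 : Cat o h) (K : RepSquares 𝐂) (𝟎 : Cat.Obj 𝐂) where
  open Cat 𝐂
  open RepSquares K
  open CRS 𝐂 K 𝟎
  open ClauseSatisfaction 𝐂

  κ-factor : ∀ {A A' B C D} {k : Hom A A'} {c : Hom A B} {α : Hom A' D} {β : Hom B D}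
             (d : Hom B C) (g' : Hom D C) →
             (D , α , β) ∈ κ k c → d ≡ β ⨾ g' → c ⨾ d ≡ k ⨾ (α ⨾ g')
  κ-factor {k = k} {c} {α} {β} d g' square d≡βg' = begin
    c ⨾ d          ≡⟨ cong (c ⨾_) d≡βg' ⟩
    c ⨾ (β ⨾ g')   ≡⟨ sym (assoc c β g') ⟩
    (c ⨾ β) ⨾ g'   ≡⟨ cong (_⨾ g') (sym (κ-commutes k c α β square)) ⟩
    (k ⨾ α) ⨾ g'   ≡⟨ assoc k α g' ⟩
    k ⨾ (α ⨾ g')   ∎
    where open ≡-Reasoning

  mutual
    shift⇒ : ∀ {A B C} (𝒜 : Cond A) (c : Hom A B) (d : Hom B C) → (c ⨾ d) ⊨ 𝒜 → d ⊨ (𝒜 ↓ c)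
    shift⇒ (cond ∀Q S) c d sat = All⇒sat∀ (shiftList S c) (forces-shift⇒ S c d (sat∀⇒All S sat))
    shift⇒ (cond ∃Q S) c d sat = Any⇒sat∃ (shiftList S c) (witnesses-shift⇒ S c d (sat∃⇒Any S sat))

    shift⇐ : ∀ {A B C} (𝒜 : Cond A) (c : Hom A B) (d : Hom B C) → d ⊨ (𝒜 ↓ c) → (c ⨾ d) ⊨ 𝒜
    shift⇐ (cond ∀Q S) c d sat = All⇒sat∀ S (forces-shift⇐ S c d (sat∀⇒All (shiftList S c) sat))
    shift⇐ (cond ∃Q S) c d sat = Any⇒sat∃ S (witnesses-shift⇐ S c d (sat∃⇒Any (shiftList S c) sat))

    -- A universal clause met by c;d is met by d in every shifted clause:
    -- a factorisation d = β;g' pastes to c;d = k;(α;g').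
    forces-shift⇒ : ∀ {A B C} (S : List (Entry A)) (c : Hom A B) (d : Hom B C) →
                    All (Forces (c ⨾ d)) S → All (Forces d) (shiftList S c)
    forces-shift⇒ [] c d [] = []
    forces-shift⇒ ((A' , k , 𝒜') ∷ S) c d (forces ∷ rest) =
      Allₚ.++⁺ (Allₚ.map⁺ (All.tabulate λ { {D , α , β} square g' d≡βg' →
                  shift⇒ 𝒜' α g' (forces (α ⨾ g') (κ-factor d g' square d≡βg')) }))
               (forces-shift⇒ S c d rest)

    -- Conversely, a factorisation c;d = k;g is represented by a square in
    -- κ(k, c) through which g and d factor.
    forces-shift⇐ : ∀ {A B C} (S : List (Entry A)) (c : Hom A B) (d : Hom B C) →
                    All (Forces d) (shiftList S c) → All (Forces (c ⨾ d)) S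
    forces-shift⇐ [] c d [] = []
    forces-shift⇐ ((A' , k , 𝒜') ∷ S) c d shifted
      with Allₚ.++⁻ _ shifted
    ... | here-clauses , rest = forces ∷ forces-shift⇐ S c d rest
      where
      forces : (g : Hom A' _) → c ⨾ d ≡ k ⨾ g → g ⊨ 𝒜'
      forces g cd≡kg with κ-represents k c g d (sym cd≡kg)
      ... | D , β₁ , β₂ , square , γ , g≡β₁γ , d≡β₂γ =
        subst (_⊨ 𝒜') (sym g≡β₁γ)
          (shift⇐ 𝒜' β₁ γ (All.lookup (Allₚ.map⁻ here-clauses) square γ d≡β₂γ))

    witnesses-shift⇒ : ∀ {A B C} (S : List (Entry A)) (c : Hom A B) (d : Hom B C) →
                       Any (Witnesses (c ⨾ d)) S → Any (Witnesses d) (shiftList S c)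
    witnesses-shift⇒ ((A' , k , 𝒜') ∷ S) c d (here (g , cd≡kg , g⊨𝒜'))
      with κ-represents k c g d (sym cd≡kg)
    ... | D , β₁ , β₂ , square , γ , g≡β₁γ , d≡β₂γ =
      Anyₚ.++⁺ˡ (Anyₚ.map⁺ (lose square
        (γ , d≡β₂γ , shift⇒ 𝒜' β₁ γ (subst (_⊨ 𝒜') g≡β₁γ g⊨𝒜'))))
    witnesses-shift⇒ ((A' , k , 𝒜') ∷ S) c d (there rest) =
      Anyₚ.++⁺ʳ _ (witnesses-shift⇒ S c d rest)

    witnesses-shift⇐ : ∀ {A B C} (S : List (Entry A)) (c : Hom A B) (d : Hom B C) →
                       Any (Witnesses d) (shiftList S c) → Any (Witnesses (c ⨾ d)) S
    witnesses-shift⇐ ((A' , k , 𝒜') ∷ S) c d shifted with Anyₚ.++⁻ _ shifted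
    ... | inj₂ rest = there (witnesses-shift⇐ S c d rest)
    ... | inj₁ here-clauses with find (Anyₚ.map⁻ {xs = κ k c} here-clauses)
    ...   | (D , α , β) , square , (g' , d≡βg' , g'⊨) =
      here (α ⨾ g' , κ-factor d g' square d≡βg' , shift⇐ 𝒜' α g' g'⊨)

  ⊨⇒id⊨↓ : ∀ {A B} (𝒜 : Cond A) (c : Hom A B) → c ⊨ 𝒜 → id ⊨ (𝒜 ↓ c)
  ⊨⇒id⊨↓ 𝒜 c c⊨𝒜 = shift⇒ 𝒜 c id (subst (_⊨ 𝒜) (sym (identityʳ c)) c⊨𝒜)

  id⊨↓⇒⊨ : ∀ {A B} (𝒜 : Cond A) (c : Hom A B) → id ⊨ (𝒜 ↓ c) → c ⊨ 𝒜
  id⊨↓⇒⊨ 𝒜 c id⊨ = subst (_⊨ 𝒜) (identityʳ c) (shift⇐ 𝒜 c id id⊨)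

module ReactionsAndContextSteps {o h s : Level} (𝐂 : Cat o h) (K : RepSquares 𝐂) (𝟎 : Cat.Obj 𝐂)
                                (𝒮 : CRS.Rule 𝐂 K 𝟎 → Set s) where
  open Cat 𝐂
  open CRS 𝐂 K 𝟎
  open ShiftProperty 𝐂 K 𝟎

  _⇝'_ : ∀ {B} → Hom 𝟎 B → Hom 𝟎 B → Set (o ⊔ h ⊔ s)
  _⇝'_ = _⇝_ 𝒮

  reaction⇒contextStep : ∀ {J B} (a : Hom 𝟎 J) (d : Hom J B) (x x' : Hom 𝟎 B) →
                         x ≡ a ⨾ d → x ⇝' x' →
                         Σ[ 𝒜 ∈ Cond B ] (CStep 𝒮 a d 𝒜 x' × id ⊨ 𝒜)
  reaction⇒contextStep a d x x' x≡ad (ρ , ρ∈𝒮 , c , x≡ℓc , x'≡rc , c⊨ℛ) =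
    Rule.ℛ ρ ↓ c , (ρ , ρ∈𝒮 , c , trans (sym x≡ad) x≡ℓc , x'≡rc , λ _ sat → sat) ,
    ⊨⇒id⊨↓ (Rule.ℛ ρ) c c⊨ℛ

  contextStep⇒reaction : ∀ {J B} (b : Hom 𝟎 J) (f : Hom J B) (ℬ : Cond B) (y b' : Hom 𝟎 B) →
                         y ≡ b ⨾ f → CStep 𝒮 b f ℬ b' → id ⊨ ℬ → y ⇝' b'
  contextStep⇒reaction b f ℬ y b' y≡bf (ρ , ρ∈𝒮 , c , bf≡ℓc , b'≡rc , ℬ⊫ℛ↓c) id⊨ℬ =
    ρ , ρ∈𝒮 , c , trans y≡bf bf≡ℓc , b'≡rc , id⊨↓⇒⊨ (Rule.ℛ ρ) c (ℬ⊫ℛ↓c id id⊨ℬ)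

  -- The forward transfer property of a conditional bisimulation (the first
  -- half of IsCondBisim); the second half is this property of the converse.
  Transfer : ∀ {r} (i : Level) → CondRel 𝒮 r → Set (o ⊔ h ⊔ s ⊔ r ⊔ Level.suc i)
  Transfer i R =
    ∀ {J K'} (a b : Hom 𝟎 J) (𝒞 : Cond J) → R a b 𝒞 →
    ∀ (f : Hom J K') (𝒜 : Cond K') (a' : Hom 𝟎 K') → CStep 𝒮 a f 𝒜 a' →
    Σ[ Ix ∈ Set i ] Σ[ b' ∈ (Ix → Hom 𝟎 K') ] Σ[ ℬ ∈ (Ix → Cond K') ] Σ[ 𝒞' ∈ (Ix → Cond K') ]
      ((∀ j → CStep 𝒮 b f (ℬ j) (b' j)) × (∀ j → R a' (b' j) (𝒞' j)) ×
       (∀ {B} (d : Hom K' B) → d ⊨ 𝒜 → d ⊨ (𝒞 ↓ f) → Σ[ j ∈ Ix ] (d ⊨ 𝒞' j × d ⊨ ℬ j)))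

  converse : ∀ {r} → CondRel 𝒮 r → CondRel 𝒮 r
  converse R a b 𝒞 = R b a 𝒞

  closure-converse : ∀ {r} (R : CondRel 𝒮 r) {B} {x y : Hom 𝟎 B} →
                     Closure 𝒮 R x y → Closure 𝒮 (converse R) y x
  closure-converse R (J , a , b , 𝒞 , Rab𝒞 , d , d⊨𝒞 , x≡ad , y≡bd) =
    J , b , a , 𝒞 , Rab𝒞 , d , d⊨𝒞 , y≡bd , x≡ad

  closure-at-id : ∀ {r} (R : CondRel 𝒮 r) {B} (a b : Hom 𝟎 B) (𝒞 : Cond B) →
                  R a b 𝒞 → id ⊨ 𝒞 → Closure 𝒮 R a b
  closure-at-id R {B} a b 𝒞 Rab𝒞 id⊨𝒞 =
    B , a , b , 𝒞 , Rab𝒞 , id , id⊨𝒞 , sym (identityʳ a) , sym (identityʳ b)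

  closure-simulates : ∀ {r i} (R : CondRel 𝒮 r) → Transfer i R →
                      ∀ {B} (x y x' : Hom 𝟎 B) → Closure 𝒮 R x y → x ⇝' x' →
                      Σ[ y' ∈ Hom 𝟎 B ] (y ⇝' y' × Closure 𝒮 R x' y')
  closure-simulates R transfer x y x' (J , a , b , 𝒞 , Rab𝒞 , d , d⊨𝒞 , x≡ad , y≡bd) x⇝x'
    with reaction⇒contextStep a d x x' x≡ad x⇝x'
  ... | 𝒜 , step , id⊨𝒜
    with transfer a b 𝒞 Rab𝒞 d 𝒜 x' step
  ... | Ix , b' , ℬ , 𝒞' , answers , related , covered
    with covered id id⊨𝒜 (⊨⇒id⊨↓ 𝒞 d d⊨𝒞)
  ... | j , id⊨𝒞' , id⊨ℬ =
    b' j , contextStep⇒reaction b d (ℬ j) y (b' j) y≡bd (answers j) id⊨ℬ ,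
    closure-at-id R x' (b' j) (𝒞' j) (related j) id⊨𝒞'

  closure-simulated : ∀ {r i} (R : CondRel 𝒮 r) → Transfer i (converse R) →
                      ∀ {B} (x y y' : Hom 𝟎 B) → Closure 𝒮 R x y → y ⇝' y' →
                      Σ[ x' ∈ Hom 𝟎 B ] (x ⇝' x' × Closure 𝒮 R x' y')
  closure-simulated R transfer x y y' R'xy y⇝y'
    with closure-simulates (converse R) transfer y x y' (closure-converse R R'xy) y⇝y'
  ... | x' , x⇝x' , R'˘y'x' = x' , x⇝x' , closure-converse (converse R) R'˘y'x'

theorem4p9 : ∀ {o h s r i : Level} (𝐂 : Cat o h) (K : RepSquares 𝐂) (𝟎 : Cat.Obj 𝐂)
               (𝒮 : CRS.Rule 𝐂 K 𝟎 → Set s) (R : CRS.CondRel 𝐂 K 𝟎 𝒮 r) →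
               CRS.IsCondBisim 𝐂 K 𝟎 𝒮 i R →
               CRS.IsBisim 𝐂 K 𝟎 𝒮 (CRS.Closure 𝐂 K 𝟎 𝒮 R)
theorem4p9 𝐂 K 𝟎 𝒮 R (forward , backward) =
  closure-simulates R forward ,
  closure-simulated R (λ b a 𝒞 → backward a b 𝒞)
  where open ReactionsAndContextSteps 𝐂 K 𝟎 𝒮
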